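{- Let $d$ be a positive integer and $q$ a prime power. For any nonempty point set $P\subset\mathbb{F}_{q}^{d}$, \[ \left|\left\{ \pi \in \mathbb{H}_{q}^d :~ |\pi \cap P| \notin \left[\frac{|P|}{2q}, \frac{2|P|}{q}\right] \right\}\right| \le \frac{8q^{d+1}}{|P|}. \]
   Context: $\mathbb{H}_q^d$ denotes the set of all hyperplanes ($(d-1)$-dimensional affine subspaces) of $\mathbb{F}_q^d$. -}

module Defs where

open import Level using (0ℓ)
open import Algebra.Bundles using (CommutativeRing)
open import Data.Nat using (ℕ; zero; suc; _<_; _≤_)
import Data.Nat as ℕ
open import Data.Fin using (Fin)
import Data.Fin as Fin
open import Data.List using (List; length; filter)
open import Data.List.Relation.Unary.Any using (Any)
open import Data.List.Relation.Unary.AllPairs using (AllPairs)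
open import Data.Product using (∃; _×_)
open import Data.Sum using (_⊎_)
open import Relation.Nullary using (¬_)
open import Relation.Binary using (Decidable)
open import Relation.Binary.PropositionalEquality using (_≡_)

-- A finite field with exactly q elements.  (q is then necessarily a prime
-- power, and for every prime power q such a field exists.)
record FiniteField (q : ℕ) : Set₁ where
  field
    commRing : CommutativeRing 0ℓ 0ℓ
  open CommutativeRing commRing public
  field
    _≟_      : Decidable _≈_
    0≉1      : ¬ (0# ≈ 1#)
    inverse  : ∀ x → ¬ (x ≈ 0#) → ∃ λ y → (x * y) ≈ 1#
    elems          : List Carrier
    elems-complete : ∀ x → Any (x ≈_) elems
    elems-distinct : AllPairs (λ x y → ¬ (x ≈ y)) elems
    elems-length   : length elems ≡ q

module _ {q : ℕ} (F : FiniteField q) where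
  open FiniteField F

  Point : ℕ → Set
  Point d = Fin d → Carrier

  _≈ᵖ_ : ∀ {d} → Point d → Point d → Set
  x ≈ᵖ y = ∀ i → x i ≈ y i

  -- a point set: a finite list of pairwise distinct points; its size is its length
  DistinctPoints : ∀ {d} → List (Point d) → Set
  DistinctPoints = AllPairs (λ x y → ¬ (x ≈ᵖ y))

  dot : ∀ {d} → Point d → Point d → Carrier
  dot {zero}  a x = 0#
  dot {suc d} a x = a Fin.zero * x Fin.zero + dot (λ i → a (Fin.suc i)) (λ i → x (Fin.suc i))

  record Hyperplane (d : ℕ) : Set where
    constructor hyp
    field
      normal   : Point d
      offset   : Carrier
      normal≠0 : ¬ (∀ i → normal i ≈ 0#)

  _∈ʰ_ : ∀ {d} → Point d → Hyperplane d → Set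
  x ∈ʰ hyp a b _ = dot a x ≈ b

  SameHyperplane : ∀ {d} → Hyperplane d → Hyperplane d → Set
  SameHyperplane π σ = ∀ x → (x ∈ʰ π → x ∈ʰ σ) × (x ∈ʰ σ → x ∈ʰ π)

  DistinctHyperplanes : ∀ {d} → List (Hyperplane d) → Set
  DistinctHyperplanes = AllPairs (λ π σ → ¬ SameHyperplane π σ)

  intersectionSize : ∀ {d} → Hyperplane d → List (Point d) → ℕ
  intersectionSize (hyp a b _) P = length (filter (λ x → dot a x ≟ b) P)

  -- |π ∩ P| ∉ [|P|/(2q), 2|P|/q], written without division:
  -- |π ∩ P| < |P|/(2q)  ⇔  2q|π ∩ P| < |P|,   |π ∩ P| > 2|P|/q  ⇔  q|π ∩ P| > 2|P|
  Unbalanced : ∀ {d} → List (Point d) → Hyperplane d → Set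
  Unbalanced P π = (2 ℕ.* q ℕ.* intersectionSize π P < length P)
                 ⊎ (2 ℕ.* length P < q ℕ.* intersectionSize π P)

module Submission where

-- For a pair (a, b) ∈ F_q^d × F_q let k(a, b) be the number of points x ∈ P with a · x = b.
-- Summing over all q^(d+1) pairs, Σ k = q^d |P|, and since two distinct points satisfy
-- a · x = a · y for at most q^(d-1) vectors a, Σ k² ≤ |P| (q^d + |P| q^(d-1)).  Hence the
-- second moment Σ (q k − |P|)² is at most q^(d+2) |P|.  A hyperplane {a · x = b} is represented
-- by the q − 1 ≥ q/2 pairs (c a, c b) with c ≠ 0, distinct hyperplanes have disjoint sets of
-- representatives, and every representative of an unbalanced hyperplane contributes more than
-- |P|²/4 to the second moment; so |H| (q/2) |P|²/4 ≤ q^(d+2) |P|.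

open import Defs
open import Data.Nat using (ℕ; _+_; _*_; _^_; _≤_)
open import Data.List using (List; length)
open import Data.List.Relation.Unary.All using (All)

open import Level using (0ℓ)
open import Data.Empty using (⊥-elim)
open import Data.Fin using (zero; suc)
open import Data.Fin.Properties using (all?)
open import Data.List using ([]; _∷_; _++_; map; filter; cartesianProductWith; cartesianProduct)
open import Data.List.Membership.Propositional using () renaming (_∈_ to _∈ₚ_)
open import Data.List.Properties using (length-++; length-map)
open import Data.List.Relation.Unary.All as All using ([]; _∷_)
import Data.List.Relation.Unary.All.Properties as Allₚ
open import Data.List.Relation.Unary.AllPairs using (AllPairs; []; _∷_)
open import Data.List.Relation.Unary.Any as Any using (Any; here; there)
import Data.List.Relation.Unary.Any.Properties as Anyₚ
open import Data.Nat using (zero; suc; _<_; z≤n; s≤s; ∣_-_∣; >-nonZero)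
open import Data.Nat.Properties
open import Data.Nat.Tactic.RingSolver using (solve-∀)
open import Data.Product using (_×_; _,_; ∃; proj₁)
open import Data.Product.Relation.Binary.Pointwise.NonDependent using (Pointwise; _×ₛ_; ×-decidable)
open import Data.Sum using (_⊎_; inj₁; inj₂; map₁)
open import Data.Unit using (⊤; tt)
import Data.Vec.Functional as V
open import Function using (_∘_)
open import Relation.Binary.Bundles using (Setoid)
import Relation.Binary.Construct.On as On
open import Relation.Binary.Definitions using () renaming (Decidable to Decidable₂)
open import Relation.Binary.PropositionalEquality as ≡
  using (_≡_; refl; sym; trans; cong; cong₂; subst; module ≡-Reasoning)
import Relation.Binary.Reasoning.Setoid
open import Relation.Nullary using (¬_; Dec; yes; no)
open import Relation.Unary using (Pred; Decidable; ∁)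

private
  variable
    A B C : Set

-- Finite sums over lists

∑ : List A → (A → ℕ) → ℕ
∑ []       f = 0
∑ (x ∷ xs) f = f x + ∑ xs f

infix 5 ∑
syntax ∑ xs (λ x → e) = ∑[ x ∈ xs ] e

module _ {f g : A → ℕ} where

  ∑-cong : ∀ xs → (∀ x → f x ≡ g x) → ∑ xs f ≡ ∑ xs g
  ∑-cong []       f≗g = refl
  ∑-cong (x ∷ xs) f≗g = cong₂ _+_ (f≗g x) (∑-cong xs f≗g)

  ∑-monoᴬ : ∀ {xs} → All (λ x → f x ≤ g x) xs → ∑ xs f ≤ ∑ xs g
  ∑-monoᴬ []           = z≤n
  ∑-monoᴬ (fx≤gx ∷ f≤g) = +-mono-≤ fx≤gx (∑-monoᴬ f≤g)

  ∑-mono : ∀ xs → (∀ x → f x ≤ g x) → ∑ xs f ≤ ∑ xs g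
  ∑-mono xs f≤g = ∑-monoᴬ (All.universal f≤g xs)

  ∑-distrib-+ : ∀ xs → ∑[ x ∈ xs ] (f x + g x) ≡ ∑ xs f + ∑ xs g
  ∑-distrib-+ []       = refl
  ∑-distrib-+ (x ∷ xs) = begin
    f x + g x + (∑[ x ∈ xs ] (f x + g x)) ≡⟨ cong (f x + g x +_) (∑-distrib-+ xs) ⟩
    f x + g x + (∑ xs f + ∑ xs g)         ≡⟨ interchange (f x) (g x) (∑ xs f) (∑ xs g) ⟩
    f x + ∑ xs f + (g x + ∑ xs g)         ∎
    where
    open ≡-Reasoning
    interchange : ∀ a b c d → a + b + (c + d) ≡ a + c + (b + d)
    interchange = solve-∀

module _ (f : A → ℕ) where

  ∑-*ˡ : ∀ c xs → ∑[ x ∈ xs ] (c * f x) ≡ c * ∑ xs f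
  ∑-*ˡ c []       = sym (*-zeroʳ c)
  ∑-*ˡ c (x ∷ xs) = trans (cong (c * f x +_) (∑-*ˡ c xs)) (sym (*-distribˡ-+ c (f x) (∑ xs f)))

  ∑-*ʳ : ∀ c xs → ∑[ x ∈ xs ] (f x * c) ≡ ∑ xs f * c
  ∑-*ʳ c xs = trans (∑-cong xs (λ x → *-comm (f x) c)) (trans (∑-*ˡ c xs) (*-comm c (∑ xs f)))

  ∑-++ : ∀ xs ys → ∑ (xs ++ ys) f ≡ ∑ xs f + ∑ ys f
  ∑-++ []       ys = refl
  ∑-++ (x ∷ xs) ys = trans (cong (f x +_) (∑-++ xs ys)) (sym (+-assoc (f x) (∑ xs f) (∑ ys f)))

∑-const : ∀ (xs : List A) c → ∑[ x ∈ xs ] c ≡ length xs * c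
∑-const []       c = refl
∑-const (x ∷ xs) c = cong (c +_) (∑-const xs c)

∑-bound : ∀ {f : A → ℕ} xs c → (∀ x → f x ≤ c) → ∑ xs f ≤ length xs * c
∑-bound xs c f≤c = ≤-trans (∑-mono xs f≤c) (≤-reflexive (∑-const xs c))

∑-map : ∀ (h : A → B) (f : B → ℕ) xs → ∑ (map h xs) f ≡ ∑[ x ∈ xs ] f (h x)
∑-map h f []       = refl
∑-map h f (x ∷ xs) = cong (f (h x) +_) (∑-map h f xs)

∑-comm : ∀ (xs : List A) (ys : List B) (f : A → B → ℕ) →
         ∑[ x ∈ xs ] ∑[ y ∈ ys ] f x y ≡ ∑[ y ∈ ys ] ∑[ x ∈ xs ] f x y
∑-comm []       ys f = sym (trans (∑-const ys 0) (*-zeroʳ (length ys)))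
∑-comm (x ∷ xs) ys f = trans (cong (∑ ys (f x) +_) (∑-comm xs ys f)) (sym (∑-distrib-+ ys))

∑*∑ : ∀ (xs : List A) (ys : List B) (f : A → ℕ) (g : B → ℕ) →
      ∑ xs f * ∑ ys g ≡ ∑[ x ∈ xs ] ∑[ y ∈ ys ] f x * g y
∑*∑ xs ys f g = trans (sym (∑-*ʳ f (∑ ys g) xs)) (∑-cong xs (λ x → sym (∑-*ˡ g (f x) ys)))

∑-cartesianProductWith : ∀ (h : A → B → C) (f : C → ℕ) xs ys →
  ∑ (cartesianProductWith h xs ys) f ≡ ∑[ x ∈ xs ] ∑[ y ∈ ys ] f (h x y)
∑-cartesianProductWith h f []       ys = refl
∑-cartesianProductWith h f (x ∷ xs) ys = begin
  ∑ (map (h x) ys ++ cartesianProductWith h xs ys) f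
    ≡⟨ ∑-++ f (map (h x) ys) _ ⟩
  ∑ (map (h x) ys) f + ∑ (cartesianProductWith h xs ys) f
    ≡⟨ cong₂ _+_ (∑-map (h x) f ys) (∑-cartesianProductWith h f xs ys) ⟩
  (∑[ y ∈ ys ] f (h x y)) + (∑[ x ∈ xs ] ∑[ y ∈ ys ] f (h x y)) ∎
  where open ≡-Reasoning

length-cartesianProductWith : ∀ (h : A → B → C) xs ys →
  length (cartesianProductWith h xs ys) ≡ length xs * length ys
length-cartesianProductWith h []       ys = refl
length-cartesianProductWith h (x ∷ xs) ys =
  trans (length-++ (map (h x) ys))
        (cong₂ _+_ (length-map (h x) ys) (length-cartesianProductWith h xs ys))

𝟙 : {P : Set} → Dec P → ℕ
𝟙 (yes _) = 1
𝟙 (no _)  = 0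

𝟙≤1 : {P : Set} (P? : Dec P) → 𝟙 P? ≤ 1
𝟙≤1 (yes _) = s≤s z≤n
𝟙≤1 (no _)  = z≤n

𝟙-cong : {P Q : Set} → (P → Q) → (Q → P) → (P? : Dec P) (Q? : Dec Q) → 𝟙 P? ≡ 𝟙 Q?
𝟙-cong P→Q Q→P (yes _) (yes _) = refl
𝟙-cong P→Q Q→P (yes p) (no ¬q) = ⊥-elim (¬q (P→Q p))
𝟙-cong P→Q Q→P (no ¬p) (yes q) = ⊥-elim (¬p (Q→P q))
𝟙-cong P→Q Q→P (no _)  (no _)  = refl

count : {P : Pred A 0ℓ} → Decidable P → List A → ℕ
count P? xs = ∑[ x ∈ xs ] 𝟙 (P? x)

module _ {P : Pred A 0ℓ} (P? : Decidable P) where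

  length-filter≡count : ∀ xs → length (filter P? xs) ≡ count P? xs
  length-filter≡count []       = refl
  length-filter≡count (x ∷ xs) with P? x
  ... | yes _ = cong suc (length-filter≡count xs)
  ... | no _  = length-filter≡count xs

  count≡0 : ∀ {xs} → All (∁ P) xs → count P? xs ≡ 0
  count≡0 {[]}     []          = refl
  count≡0 {x ∷ xs} (¬px ∷ ¬ps) with P? x
  ... | yes px = ⊥-elim (¬px px)
  ... | no _   = count≡0 ¬ps

  1≤count : ∀ {xs} → Any P xs → 1 ≤ count P? xs
  1≤count {x ∷ xs} (here px) with P? x
  ... | yes _  = s≤s z≤n
  ... | no ¬px = ⊥-elim (¬px px)
  1≤count {x ∷ xs} (there p) = ≤-trans (1≤count p) (m≤n+m _ (𝟙 (P? x)))

  count≤1 : ∀ {R : A → A → Set} {xs} → AllPairs (λ x y → ¬ R x y) xs →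
            (∀ {x y} → P x → P y → R x y) → count P? xs ≤ 1
  count≤1 {xs = []}     []           P⇒R = z≤n
  count≤1 {xs = x ∷ xs} (x≁xs ∷ xs!) P⇒R with P? x
  ... | yes px = ≤-reflexive (cong suc (count≡0 (All.map (λ x≁y py → x≁y (P⇒R px py)) x≁xs)))
  ... | no _   = count≤1 xs! P⇒R

count-cong : {P Q : Pred A 0ℓ} (P? : Decidable P) (Q? : Decidable Q) →
             (∀ {x} → P x → Q x) → (∀ {x} → Q x → P x) → ∀ xs → count P? xs ≡ count Q? xs
count-cong P? Q? P⇒Q Q⇒P xs = ∑-cong xs (λ x → 𝟙-cong P⇒Q Q⇒P (P? x) (Q? x))

module _ (S : Setoid 0ℓ 0ℓ) (_≟_ : Decidable₂ (Setoid._≈_ S)) where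
  open Setoid S using (_≈_) renaming (Carrier to X; sym to ≈-sym; trans to ≈-trans)
  open import Data.List.Membership.Setoid S using (_∈_)
  open import Data.List.Relation.Unary.Unique.Setoid S using (Unique)
  open import Data.List.Relation.Binary.Subset.Setoid S using (_⊆_)

  module _ {g : X → ℕ} (g-resp : ∀ {x y} → x ≈ y → g x ≡ g y) where

    ∈⇒≤∑-matching : ∀ {y xs} → y ∈ xs → g y ≤ ∑[ x ∈ xs ] 𝟙 (y ≟ x) * g x
    ∈⇒≤∑-matching {y} {x ∷ xs} (here y≈x) with y ≟ x
    ... | yes _  = ≤-trans (≤-reflexive (trans (g-resp y≈x) (sym (+-identityʳ (g x))))) (m≤m+n _ _)
    ... | no y≉x = ⊥-elim (y≉x y≈x)
    ∈⇒≤∑-matching {y} {x ∷ xs} (there y∈xs) =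
      ≤-trans (∈⇒≤∑-matching y∈xs) (m≤n+m _ (𝟙 (y ≟ x) * g x))

    -- Each x is matched by at most one y, because the ys are pairwise inequivalent.
    ∑-mono-⊆ : ∀ {xs ys} → Unique ys → ys ⊆ xs → ∑ ys g ≤ ∑ xs g
    ∑-mono-⊆ {xs} {ys} ys! ys⊆xs = begin
      ∑ ys g
        ≤⟨ ∑-monoᴬ (All.tabulateₛ S (λ y∈ys → ∈⇒≤∑-matching (ys⊆xs y∈ys))) ⟩
      (∑[ y ∈ ys ] ∑[ x ∈ xs ] 𝟙 (y ≟ x) * g x)
        ≡⟨ ∑-comm ys xs _ ⟩
      (∑[ x ∈ xs ] ∑[ y ∈ ys ] 𝟙 (y ≟ x) * g x)
        ≡⟨ ∑-cong xs (λ x → ∑-*ʳ (λ y → 𝟙 (y ≟ x)) (g x) ys) ⟩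
      (∑[ x ∈ xs ] count (_≟ x) ys * g x)
        ≤⟨ ∑-mono xs (λ x → *-monoˡ-≤ (g x) (count≤1 (_≟ x) ys! (λ y≈x y′≈x → ≈-trans y≈x (≈-sym y′≈x)))) ⟩
      (∑[ x ∈ xs ] 1 * g x)
        ≡⟨ ∑-cong xs (λ x → *-identityˡ (g x)) ⟩
      ∑ xs g ∎
      where open ≤-Reasoning

∣m-n∣²+2mn≡m²+n² : ∀ m n → ∣ m - n ∣ * ∣ m - n ∣ + 2 * m * n ≡ m * m + n * n
∣m-n∣²+2mn≡m²+n² m n with ≤-total m n
... | inj₁ m≤n with t , refl ← m≤n⇒∃[o]m+o≡n m≤n rewrite ∣m-m+n∣≡n m t = identity m t
  where
  identity : ∀ m t → t * t + 2 * m * (m + t) ≡ m * m + (m + t) * (m + t)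
  identity = solve-∀
... | inj₂ n≤m with t , refl ← m≤n⇒∃[o]m+o≡n n≤m rewrite ∣-∣-comm (n + t) n | ∣m-m+n∣≡n n t =
  identity n t
  where
  identity : ∀ n t → t * t + 2 * (n + t) * n ≡ (n + t) * (n + t) + n * n
  identity = solve-∀

n<2∣m-n∣ : ∀ m n → 2 * m < n ⊎ 2 * n < m → n < 2 * ∣ m - n ∣
n<2∣m-n∣ m n (inj₁ 2m<n) = +-cancelˡ-< n n (2 * ∣ m - n ∣) (begin-strict
  n + n                               ≤⟨ +-mono-≤ (m≤n+∣n-m∣ n m) (m≤n+∣n-m∣ n m) ⟩
  (m + ∣ m - n ∣) + (m + ∣ m - n ∣)   ≡⟨ regroup m ∣ m - n ∣ ⟩
  2 * m + 2 * ∣ m - n ∣               <⟨ +-monoˡ-< (2 * ∣ m - n ∣) 2m<n ⟩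
  n + 2 * ∣ m - n ∣                   ∎)
  where
  open ≤-Reasoning
  regroup : ∀ a b → (a + b) + (a + b) ≡ 2 * a + 2 * b
  regroup = solve-∀
n<2∣m-n∣ m n (inj₂ 2n<m) = begin-strict
  n               <⟨ +-cancelʳ-< n n ∣ m - n ∣ (<-≤-trans n+n<m (m≤∣m-n∣+n m n)) ⟩
  ∣ m - n ∣       ≤⟨ m≤m+n ∣ m - n ∣ (∣ m - n ∣ + 0) ⟩
  2 * ∣ m - n ∣   ∎
  where
  open ≤-Reasoning
  n+n<m : n + n < m
  n+n<m = subst (_< m) (cong (n +_) (+-identityʳ n)) 2n<m

-- Linear equations over a finite field

module _ {q : ℕ} (F : FiniteField q) where
  open FiniteField F using
    ( Carrier; _≈_; 0#; 1#; -_; setoid; commutativeSemiring; +-group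
    ; inverse; elems; elems-complete; elems-distinct; elems-length; 0≉1 )
    renaming ( _+_ to _+ᶠ_; _*_ to _*ᶠ_; _≟_ to infix 4 _≟ᶠ_
             ; +-cong to +ᶠ-cong; +-identityˡ to +ᶠ-identityˡ; +-identityʳ to +ᶠ-identityʳ
             ; *-cong to *ᶠ-cong; *-comm to *ᶠ-comm; *-identityˡ to *ᶠ-identityˡ; zeroʳ to *ᶠ-zeroʳ
             ; refl to ≈-refl; sym to ≈-sym; trans to ≈-trans )
  open import Algebra.Properties.Group +-group
    using (\\-leftDividesˡ; \\-leftDividesʳ; //-rightDividesˡ; //-rightDividesʳ; x∙y⁻¹≈ε⇒x≈y; x≈y⇒x∙y⁻¹≈ε)
  open import Algebra.Solver.Ring.NaturalCoefficients.Default commutativeSemiring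
    using (solve; _:=_; _:+_; _:*_)
  open import Data.Vec.Functional.Relation.Binary.Equality.Setoid setoid using (_≋_; ≋-setoid)
  module ≈-Reasoning = Relation.Binary.Reasoning.Setoid setoid

  infix 7 _·_
  _·_ : ∀ {d} → Point F d → Point F d → Carrier
  a · x = dot F a x

  *ᶠ-cancelˡ-≉0 : ∀ {c u v} → ¬ c ≈ 0# → c *ᶠ u ≈ c *ᶠ v → u ≈ v
  *ᶠ-cancelˡ-≉0 {c} {u} {v} c≉0 cu≈cv with c⁻¹ , cc⁻¹≈1 ← inverse c c≉0 = begin
    u                  ≈⟨ ≈-sym (*ᶠ-identityˡ u) ⟩
    1# *ᶠ u            ≈⟨ *ᶠ-cong (≈-sym cc⁻¹≈1) ≈-refl ⟩
    (c *ᶠ c⁻¹) *ᶠ u    ≈⟨ reassoc c c⁻¹ u ⟩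
    c⁻¹ *ᶠ (c *ᶠ u)    ≈⟨ *ᶠ-cong ≈-refl cu≈cv ⟩
    c⁻¹ *ᶠ (c *ᶠ v)    ≈⟨ ≈-sym (reassoc c c⁻¹ v) ⟩
    (c *ᶠ c⁻¹) *ᶠ v    ≈⟨ *ᶠ-cong cc⁻¹≈1 ≈-refl ⟩
    1# *ᶠ v            ≈⟨ *ᶠ-identityˡ v ⟩
    v                  ∎
    where
    open ≈-Reasoning
    reassoc : ∀ c c⁻¹ u → (c *ᶠ c⁻¹) *ᶠ u ≈ c⁻¹ *ᶠ (c *ᶠ u)
    reassoc = solve 3 (λ c c⁻¹ u → (c :* c⁻¹) :* u := c⁻¹ :* (c :* u)) ≈-refl

  *ᶠ-cancelʳ-≉0 : ∀ {c u v} → ¬ c ≈ 0# → u *ᶠ c ≈ v *ᶠ c → u ≈ v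
  *ᶠ-cancelʳ-≉0 {c} {u} {v} c≉0 uc≈vc =
    *ᶠ-cancelˡ-≉0 c≉0 (≈-trans (*ᶠ-comm c u) (≈-trans uc≈vc (*ᶠ-comm v c)))

  x+y≈z⇒y≈-x+z : ∀ {x y z} → x +ᶠ y ≈ z → y ≈ - x +ᶠ z
  x+y≈z⇒y≈-x+z {x} {y} x+y≈z = ≈-trans (≈-sym (\\-leftDividesʳ x y)) (+ᶠ-cong ≈-refl x+y≈z)

  y≈-x+z⇒x+y≈z : ∀ {x y z} → y ≈ - x +ᶠ z → x +ᶠ y ≈ z
  y≈-x+z⇒x+y≈z {x} {y} {z} y≈-x+z = ≈-trans (+ᶠ-cong ≈-refl y≈-x+z) (\\-leftDividesˡ x z)

  dot-congˡ : ∀ {d} {a a′ : Point F d} x → a ≋ a′ → a · x ≈ a′ · x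
  dot-congˡ {zero}  x a≋a′ = ≈-refl
  dot-congˡ {suc d} x a≋a′ =
    +ᶠ-cong (*ᶠ-cong (a≋a′ zero) ≈-refl) (dot-congˡ (V.tail x) (a≋a′ ∘ suc))

  dot-congʳ : ∀ {d} (a : Point F d) {x x′} → x ≋ x′ → a · x ≈ a · x′
  dot-congʳ {zero}  a x≋x′ = ≈-refl
  dot-congʳ {suc d} a x≋x′ =
    +ᶠ-cong (*ᶠ-cong ≈-refl (x≋x′ zero)) (dot-congʳ (V.tail a) (x≋x′ ∘ suc))

  dot-*ˡ : ∀ {d} c (a x : Point F d) → (λ i → c *ᶠ a i) · x ≈ c *ᶠ (a · x)
  dot-*ˡ {zero}  c a x = ≈-sym (*ᶠ-zeroʳ c)
  dot-*ˡ {suc d} c a x = begin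
    c *ᶠ a zero *ᶠ x zero +ᶠ (λ i → c *ᶠ a (suc i)) · V.tail x
      ≈⟨ +ᶠ-cong ≈-refl (dot-*ˡ c (V.tail a) (V.tail x)) ⟩
    c *ᶠ a zero *ᶠ x zero +ᶠ c *ᶠ (V.tail a · V.tail x)
      ≈⟨ distrib c (a zero) (x zero) (V.tail a · V.tail x) ⟩
    c *ᶠ (a zero *ᶠ x zero +ᶠ V.tail a · V.tail x) ∎
    where
    open ≈-Reasoning
    distrib : ∀ c u v w → c *ᶠ u *ᶠ v +ᶠ c *ᶠ w ≈ c *ᶠ (u *ᶠ v +ᶠ w)
    distrib = solve 4 (λ c u v w → c :* u :* v :+ c :* w := c :* (u :* v :+ w)) ≈-refl

  dot-+ʳ : ∀ {d} (a x y : Point F d) → a · (λ i → x i +ᶠ y i) ≈ a · x +ᶠ a · y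
  dot-+ʳ {zero}  a x y = ≈-sym (+ᶠ-identityˡ 0#)
  dot-+ʳ {suc d} a x y = begin
    a zero *ᶠ (x zero +ᶠ y zero) +ᶠ V.tail a · (λ i → x (suc i) +ᶠ y (suc i))
      ≈⟨ +ᶠ-cong ≈-refl (dot-+ʳ (V.tail a) (V.tail x) (V.tail y)) ⟩
    a zero *ᶠ (x zero +ᶠ y zero) +ᶠ (V.tail a · V.tail x +ᶠ V.tail a · V.tail y)
      ≈⟨ distrib (a zero) (x zero) (y zero) (V.tail a · V.tail x) (V.tail a · V.tail y) ⟩
    (a zero *ᶠ x zero +ᶠ V.tail a · V.tail x) +ᶠ (a zero *ᶠ y zero +ᶠ V.tail a · V.tail y) ∎
    where
    open ≈-Reasoning
    distrib : ∀ a u v s t → a *ᶠ (u +ᶠ v) +ᶠ (s +ᶠ t) ≈ (a *ᶠ u +ᶠ s) +ᶠ (a *ᶠ v +ᶠ t)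
    distrib = solve 5 (λ a u v s t → a :* (u :+ v) :+ (s :+ t) := (a :* u :+ s) :+ (a :* v :+ t)) ≈-refl

  dot-zeroʳ : ∀ {d} (a u : Point F d) → (∀ i → u i ≈ 0#) → a · u ≈ 0#
  dot-zeroʳ {zero}  a u u≈0 = ≈-refl
  dot-zeroʳ {suc d} a u u≈0 = begin
    a zero *ᶠ u zero +ᶠ V.tail a · V.tail u
      ≈⟨ +ᶠ-cong (*ᶠ-cong ≈-refl (u≈0 zero)) (dot-zeroʳ (V.tail a) (V.tail u) (u≈0 ∘ suc)) ⟩
    a zero *ᶠ 0# +ᶠ 0#  ≈⟨ +ᶠ-cong (*ᶠ-zeroʳ (a zero)) ≈-refl ⟩
    0# +ᶠ 0#            ≈⟨ +ᶠ-identityˡ 0# ⟩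
    0#                  ∎
    where open ≈-Reasoning

  points : ∀ d → List (Point F d)
  points zero    = V.[] ∷ []
  points (suc d) = cartesianProductWith V._∷_ elems (points d)

  length-points : ∀ d → length (points d) ≡ q ^ d
  length-points zero    = refl
  length-points (suc d) = trans (length-cartesianProductWith V._∷_ elems (points d))
                                (cong₂ _*_ elems-length (length-points d))

  points-complete : ∀ d (x : Point F d) → Any (x ≋_) (points d)
  points-complete zero    x = here (λ ())
  points-complete (suc d) x = Anyₚ.cartesianProductWith⁺ V._∷_ ≋-∷
    (elems-complete (V.head x)) (points-complete d (V.tail x))
    where
    ≋-∷ : ∀ {c a} → V.head x ≈ c → V.tail x ≋ a → x ≋ (c V.∷ a)
    ≋-∷ x₀≈c _  zero    = x₀≈c
    ≋-∷ _  x′≋a (suc i) = x′≋a i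

  _≋?_ : ∀ {d} → Decidable₂ (_≋_ {d})
  x ≋? y = all? (λ i → x i ≟ᶠ y i)

  count-elems : ∀ v → count (v ≟ᶠ_) elems ≡ 1
  count-elems v = ≤-antisym (count≤1 (v ≟ᶠ_) elems-distinct (λ v≈x v≈y → ≈-trans (≈-sym v≈x) v≈y))
                            (1≤count (v ≟ᶠ_) (elems-complete v))

  count-points-suc : ∀ e (u : Point F (suc e)) c →
    count (λ a → a · u ≟ᶠ c) (points (suc e)) ≡
    (∑[ a₀ ∈ elems ] count (λ a′ → a₀ *ᶠ V.head u +ᶠ a′ · V.tail u ≟ᶠ c) (points e))
  count-points-suc e u c = ∑-cartesianProductWith V._∷_ (λ a → 𝟙 (a · u ≟ᶠ c)) elems (points e)

  -- Split a = (a₀, a′) and u = (u₀, u′): if u′ ≈ 0 then u₀ ≉ 0 determines a₀ and a′ is free;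
  -- otherwise every a₀ leaves the equation a′ · u′ ≈ c - a₀ u₀ in one dimension less.
  count-solutions : ∀ e (u : Point F (suc e)) → ¬ (∀ i → u i ≈ 0#) → ∀ c →
                    count (λ a → a · u ≟ᶠ c) (points (suc e)) ≤ q ^ e
  count-solutions e u u≉0 c with all? (λ i → V.tail u i ≟ᶠ 0#)
  count-solutions e u u≉0 c | yes u′≈0 = begin
    count (λ a → a · u ≟ᶠ c) (points (suc e))
      ≡⟨ count-points-suc e u c ⟩
    (∑[ a₀ ∈ elems ] count (λ a′ → a₀ *ᶠ u₀ +ᶠ a′ · u′ ≟ᶠ c) (points e))
      ≡⟨ ∑-cong elems tail-free ⟩
    (∑[ a₀ ∈ elems ] length (points e) * 𝟙 (a₀ *ᶠ u₀ ≟ᶠ c))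
      ≡⟨ ∑-*ˡ (λ a₀ → 𝟙 (a₀ *ᶠ u₀ ≟ᶠ c)) (length (points e)) elems ⟩
    length (points e) * count (λ a₀ → a₀ *ᶠ u₀ ≟ᶠ c) elems
      ≤⟨ *-monoʳ-≤ (length (points e)) (count≤1 (λ a₀ → a₀ *ᶠ u₀ ≟ᶠ c) elems-distinct a₀-unique) ⟩
    length (points e) * 1
      ≡⟨ trans (*-identityʳ _) (length-points e) ⟩
    q ^ e ∎
    where
    open ≤-Reasoning
    u₀ = V.head u
    u′ = V.tail u
    u₀≉0 : ¬ u₀ ≈ 0#
    u₀≉0 u₀≈0 = u≉0 λ { zero → u₀≈0 ; (suc i) → u′≈0 i }
    a₀-unique : ∀ {a₀ b₀} → a₀ *ᶠ u₀ ≈ c → b₀ *ᶠ u₀ ≈ c → a₀ ≈ b₀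
    a₀-unique a₀u₀≈c b₀u₀≈c = *ᶠ-cancelʳ-≉0 u₀≉0 (≈-trans a₀u₀≈c (≈-sym b₀u₀≈c))
    tail-vanishes : ∀ a₀ a′ → a₀ *ᶠ u₀ +ᶠ a′ · u′ ≈ a₀ *ᶠ u₀
    tail-vanishes a₀ a′ = ≈-trans (+ᶠ-cong ≈-refl (dot-zeroʳ a′ u′ u′≈0)) (+ᶠ-identityʳ _)
    tail-free : ∀ a₀ → count (λ a′ → a₀ *ᶠ u₀ +ᶠ a′ · u′ ≟ᶠ c) (points e) ≡
                       length (points e) * 𝟙 (a₀ *ᶠ u₀ ≟ᶠ c)
    tail-free a₀ = trans (∑-cong (points e) (λ a′ → 𝟙-cong (≈-trans (≈-sym (tail-vanishes a₀ a′)))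
                                                           (≈-trans (tail-vanishes a₀ a′)) _ _))
                         (∑-const (points e) _)
  count-solutions zero    u u≉0 c | no u′≉0 = ⊥-elim (u′≉0 (λ ()))
  count-solutions (suc e) u u≉0 c | no u′≉0 = begin
    count (λ a → a · u ≟ᶠ c) (points (suc (suc e)))
      ≡⟨ count-points-suc (suc e) u c ⟩
    (∑[ a₀ ∈ elems ] count (λ a′ → a₀ *ᶠ V.head u +ᶠ a′ · V.tail u ≟ᶠ c) (points (suc e)))
      ≤⟨ ∑-bound elems (q ^ e) fiber-bound ⟩
    length elems * q ^ e
      ≡⟨ cong (_* q ^ e) elems-length ⟩
    q ^ suc e ∎
    where
    open ≤-Reasoning
    fiber-bound : ∀ a₀ → count (λ a′ → a₀ *ᶠ V.head u +ᶠ a′ · V.tail u ≟ᶠ c) (points (suc e)) ≤ q ^ e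
    fiber-bound a₀ = begin
      count (λ a′ → a₀ *ᶠ V.head u +ᶠ a′ · V.tail u ≟ᶠ c) (points (suc e))
        ≡⟨ count-cong _ _ x+y≈z⇒y≈-x+z y≈-x+z⇒x+y≈z (points (suc e)) ⟩
      count (λ a′ → a′ · V.tail u ≟ᶠ - (a₀ *ᶠ V.head u) +ᶠ c) (points (suc e))
        ≤⟨ count-solutions e (V.tail u) u′≉0 (- (a₀ *ᶠ V.head u) +ᶠ c) ⟩
      q ^ e ∎

  count-agreements : ∀ e {x y : Point F (suc e)} → ¬ x ≋ y →
                     count (λ a → a · x ≟ᶠ a · y) (points (suc e)) ≤ q ^ e
  count-agreements e {x} {y} x≉y = begin
    count (λ a → a · x ≟ᶠ a · y) (points (suc e))
      ≡⟨ count-cong (λ a → a · x ≟ᶠ a · y) (λ a → a · w ≟ᶠ 0#)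
                    (λ {a} → agree⇒w≈0 {a}) (λ {a} → w≈0⇒agree {a}) (points (suc e)) ⟩
    count (λ a → a · w ≟ᶠ 0#) (points (suc e))
      ≤⟨ count-solutions e w w≉0 0# ⟩
    q ^ e ∎
    where
    open ≤-Reasoning
    w : Point F (suc e)
    w i = x i +ᶠ - y i
    w≉0 : ¬ (∀ i → w i ≈ 0#)
    w≉0 w≈0 = x≉y (λ i → x∙y⁻¹≈ε⇒x≈y (x i) (y i) (w≈0 i))
    aw+ay≈ax : ∀ a → a · w +ᶠ a · y ≈ a · x
    aw+ay≈ax a = ≈-trans (≈-sym (dot-+ʳ a w y)) (dot-congʳ a (λ i → //-rightDividesˡ (y i) (x i)))
    agree⇒w≈0 : ∀ {a} → a · x ≈ a · y → a · w ≈ 0#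
    agree⇒w≈0 {a} ax≈ay =
      ≈-trans (≈-sym (//-rightDividesʳ (a · y) (a · w)))
              (≈-trans (+ᶠ-cong (aw+ay≈ax a) ≈-refl) (x≈y⇒x∙y⁻¹≈ε ax≈ay))
    w≈0⇒agree : ∀ {a} → a · w ≈ 0# → a · x ≈ a · y
    w≈0⇒agree {a} aw≈0 =
      ≈-trans (≈-sym (aw+ay≈ax a)) (≈-trans (+ᶠ-cong aw≈0 ≈-refl) (+ᶠ-identityˡ (a · y)))

  𝟙[u≈b]*𝟙[v≈b]≡𝟙[u≈v]*𝟙[u≈b] : ∀ u v b → 𝟙 (u ≟ᶠ b) * 𝟙 (v ≟ᶠ b) ≡ 𝟙 (u ≟ᶠ v) * 𝟙 (u ≟ᶠ b)
  𝟙[u≈b]*𝟙[v≈b]≡𝟙[u≈v]*𝟙[u≈b] u v b with u ≟ᶠ b | v ≟ᶠ b | u ≟ᶠ v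
  ... | yes u≈b | yes v≈b | no u≉v  = ⊥-elim (u≉v (≈-trans u≈b (≈-sym v≈b)))
  ... | yes u≈b | no v≉b  | yes u≈v = ⊥-elim (v≉b (≈-trans (≈-sym u≈v) u≈b))
  ... | yes _   | yes _   | yes _   = refl
  ... | yes _   | no _    | no _    = refl
  ... | no _    | _       | yes _   = refl
  ... | no _    | _       | no _    = refl

  ∑-common-offsets : ∀ u v → ∑[ b ∈ elems ] 𝟙 (u ≟ᶠ b) * 𝟙 (v ≟ᶠ b) ≡ 𝟙 (u ≟ᶠ v)
  ∑-common-offsets u v = begin
    (∑[ b ∈ elems ] 𝟙 (u ≟ᶠ b) * 𝟙 (v ≟ᶠ b)) ≡⟨ ∑-cong elems (𝟙[u≈b]*𝟙[v≈b]≡𝟙[u≈v]*𝟙[u≈b] u v) ⟩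
    (∑[ b ∈ elems ] 𝟙 (u ≟ᶠ v) * 𝟙 (u ≟ᶠ b)) ≡⟨ ∑-*ˡ (λ b → 𝟙 (u ≟ᶠ b)) (𝟙 (u ≟ᶠ v)) elems ⟩
    𝟙 (u ≟ᶠ v) * count (u ≟ᶠ_) elems          ≡⟨ cong (𝟙 (u ≟ᶠ v) *_) (count-elems u) ⟩
    𝟙 (u ≟ᶠ v) * 1                             ≡⟨ *-identityʳ _ ⟩
    𝟙 (u ≟ᶠ v)                                 ∎
    where open ≡-Reasoning

  -- Nonzero scalars and the representatives of a hyperplane

  Nonzero : Set
  Nonzero = ∃ λ c → ¬ c ≈ 0#

  nonzeros : List Carrier → List Nonzero
  nonzeros []       = []
  nonzeros (c ∷ cs) with c ≟ᶠ 0#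
  ... | yes _  = nonzeros cs
  ... | no c≉0 = (c , c≉0) ∷ nonzeros cs

  length-nonzeros : ∀ cs → length cs ≡ length (nonzeros cs) + count (_≟ᶠ 0#) cs
  length-nonzeros []       = refl
  length-nonzeros (c ∷ cs) with c ≟ᶠ 0#
  ... | yes _ = trans (cong suc (length-nonzeros cs)) (sym (+-suc _ _))
  ... | no _  = cong suc (length-nonzeros cs)

  All-nonzeros : ∀ {R : Carrier → Set} {cs} → All R cs → All (R ∘ proj₁) (nonzeros cs)
  All-nonzeros {cs = []}     []         = []
  All-nonzeros {cs = c ∷ cs} (rc ∷ rcs) with c ≟ᶠ 0#
  ... | yes _ = All-nonzeros rcs
  ... | no _  = rc ∷ All-nonzeros rcs

  nonzeros-unique : ∀ {cs} → AllPairs (λ c c′ → ¬ c ≈ c′) cs →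
                    AllPairs (λ c c′ → ¬ proj₁ c ≈ proj₁ c′) (nonzeros cs)
  nonzeros-unique {[]}     []          = []
  nonzeros-unique {c ∷ cs} (c∉cs ∷ cs!) with c ≟ᶠ 0#
  ... | yes _ = nonzeros-unique cs!
  ... | no _  = All-nonzeros c∉cs ∷ nonzeros-unique cs!

  1≤length-nonzeros : ∀ {cs} → Any (λ c → ¬ c ≈ 0#) cs → 1 ≤ length (nonzeros cs)
  1≤length-nonzeros {c ∷ cs} (here c≉0) with c ≟ᶠ 0#
  ... | yes c≈0 = ⊥-elim (c≉0 c≈0)
  ... | no _    = s≤s z≤n
  1≤length-nonzeros {c ∷ cs} (there p) with c ≟ᶠ 0#
  ... | yes _ = 1≤length-nonzeros p
  ... | no _  = s≤s z≤n

  units : List Nonzero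
  units = nonzeros elems

  1≤length-units : 1 ≤ length units
  1≤length-units =
    1≤length-nonzeros (Any.map (λ 1≈c c≈0 → 0≉1 (≈-sym (≈-trans 1≈c c≈0))) (elems-complete 1#))

  q≤2*length-units : q ≤ 2 * length units
  q≤2*length-units = begin
    q                                    ≡⟨ sym elems-length ⟩
    length elems                         ≡⟨ length-nonzeros elems ⟩
    length units + count (_≟ᶠ 0#) elems  ≤⟨ +-monoʳ-≤ (length units) at-most-one-zero ⟩
    length units + 1                     ≤⟨ +-monoʳ-≤ (length units) 1≤length-units ⟩
    length units + length units          ≡⟨ cong (length units +_) (sym (+-identityʳ _)) ⟩
    2 * length units                     ∎
    where
    open ≤-Reasoning
    at-most-one-zero : count (_≟ᶠ 0#) elems ≤ 1
    at-most-one-zero = count≤1 (_≟ᶠ 0#) elems-distinct (λ c≈0 c′≈0 → ≈-trans c≈0 (≈-sym c′≈0))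

  scale : ∀ {d} → Hyperplane F d → Nonzero → Point F d × Carrier
  scale (hyp a b _) (c , _) = (λ i → c *ᶠ a i) , c *ᶠ b

  copies : ∀ {d} → List (Hyperplane F d) → List (Point F d × Carrier)
  copies H = cartesianProductWith scale H units

  module _ {d : ℕ} where
    open Setoid (≋-setoid d ×ₛ setoid) using ()
      renaming (_≈_ to _≈ₚ_; sym to ≈ₚ-sym; trans to ≈ₚ-trans)
    open import Data.List.Relation.Binary.Disjoint.Setoid (≋-setoid d ×ₛ setoid) using (Disjoint)
    open import Data.List.Relation.Unary.Unique.Setoid using (Unique)
    open import Data.List.Relation.Unary.Unique.Setoid.Properties using (++⁺; map⁺)

    scale-injective : ∀ π {c c′ : Nonzero} → scale {d} π c ≈ₚ scale π c′ → proj₁ c ≈ proj₁ c′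
    scale-injective (hyp a b a≉0) {c , _} {c′ , _} (ca≋c′a , _) with c ≟ᶠ c′
    ... | yes c≈c′ = c≈c′
    ... | no c≉c′  = ⊥-elim (a≉0 a≈0)
      where
      a≈0 : ∀ i → a i ≈ 0#
      a≈0 i with a i ≟ᶠ 0#
      ... | yes aᵢ≈0 = aᵢ≈0
      ... | no aᵢ≉0  = ⊥-elim (c≉c′ (*ᶠ-cancelʳ-≉0 aᵢ≉0 (ca≋c′a i)))

    scale-sameHyperplane : ∀ {π σ : Hyperplane F d} {c c′} →
                           scale π c ≈ₚ scale σ c′ → SameHyperplane F π σ
    scale-sameHyperplane {hyp a b _} {hyp a′ b′ _} {c , c≉0} {c′ , c′≉0} (ca≋c′a′ , cb≈c′b′) x =
      rescale c≉0 c′≉0 ca≋c′a′ cb≈c′b′ , rescale c′≉0 c≉0 (λ i → ≈-sym (ca≋c′a′ i)) (≈-sym cb≈c′b′)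
      where
      rescale : ∀ {c c′ a a′ b b′} → ¬ c ≈ 0# → ¬ c′ ≈ 0# →
                (λ i → c *ᶠ a i) ≋ (λ i → c′ *ᶠ a′ i) → c *ᶠ b ≈ c′ *ᶠ b′ → a · x ≈ b → a′ · x ≈ b′
      rescale {c} {c′} {a} {a′} c≉0 c′≉0 ca≋c′a′ cb≈c′b′ ax≈b = *ᶠ-cancelˡ-≉0 c′≉0
        (≈-trans (≈-sym (dot-*ˡ c′ a′ x)) (≈-trans (≈-sym (dot-congˡ x ca≋c′a′))
          (≈-trans (dot-*ˡ c a x) (≈-trans (*ᶠ-cong ≈-refl ax≈b) cb≈c′b′))))

    copies-unique : ∀ {H : List (Hyperplane F d)} → DistinctHyperplanes F H →
                    Unique (≋-setoid d ×ₛ setoid) (copies H)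
    copies-unique {[]}    []         = []
    copies-unique {π ∷ H} (π∉H ∷ H!) =
      ++⁺ (≋-setoid d ×ₛ setoid) copies-of-π-unique (copies-unique H!) disjoint
      where
      copies-of-π-unique : Unique (≋-setoid d ×ₛ setoid) (map (scale π) units)
      copies-of-π-unique = map⁺ (On.setoid setoid proj₁) (≋-setoid d ×ₛ setoid)
                                (λ {c} {c′} → scale-injective π {c} {c′}) (nonzeros-unique elems-distinct)
      disjoint : Disjoint (map (scale π) units) (copies H)
      disjoint {v} (v∈πs , v∈Hs) with c , v≈πc ← Any.satisfied (Anyₚ.map⁻ v∈πs) =
        Allₚ.All¬⇒¬Any π∉H
          (proj₁ (Anyₚ.cartesianProductWith⁻ scale {P = SameHyperplane F π} {Q = λ _ → ⊤}
                                             (λ {σ} {c′} → same {σ} {c′}) H units v∈Hs))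
        where
        same : ∀ {σ c′} → v ≈ₚ scale σ c′ → SameHyperplane F π σ × ⊤
        same {σ} {c′} v≈σc′ = scale-sameHyperplane {π} {σ} {c} {c′} (≈ₚ-trans (≈ₚ-sym v≈πc) v≈σc′) , tt

  -- Incidences of a point set with all pairs (a, b)

  module _ (e : ℕ) (P : List (Point F (suc e))) where

    N : ℕ
    N = length P

    incidence : Point F (suc e) × Carrier → ℕ
    incidence (a , b) = count (λ x → a · x ≟ᶠ b) P

    deviation : Point F (suc e) × Carrier → ℕ
    deviation p = ∣ q * incidence p - N ∣

    pairs : List (Point F (suc e) × Carrier)
    pairs = cartesianProduct (points (suc e)) elems

    length-pairs : length pairs ≡ q ^ suc e * q
    length-pairs = trans (length-cartesianProductWith _,_ (points (suc e)) elems)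
                         (cong₂ _*_ (length-points (suc e)) elems-length)

    ∑-incidence : ∑ pairs incidence ≡ q ^ suc e * N
    ∑-incidence = begin
      ∑ pairs incidence
        ≡⟨ ∑-cartesianProductWith _,_ incidence (points (suc e)) elems ⟩
      (∑[ a ∈ points (suc e) ] ∑[ b ∈ elems ] incidence (a , b))
        ≡⟨ ∑-cong (points (suc e)) ∑-offsets ⟩
      (∑[ a ∈ points (suc e) ] N)
        ≡⟨ trans (∑-const (points (suc e)) N) (cong (_* N) (length-points (suc e))) ⟩
      q ^ suc e * N ∎
      where
      open ≡-Reasoning
      ∑-offsets : ∀ a → ∑[ b ∈ elems ] incidence (a , b) ≡ N
      ∑-offsets a = begin
        (∑[ b ∈ elems ] ∑[ x ∈ P ] 𝟙 (a · x ≟ᶠ b)) ≡⟨ ∑-comm elems P _ ⟩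
        (∑[ x ∈ P ] count (a · x ≟ᶠ_) elems)        ≡⟨ ∑-cong P (λ x → count-elems (a · x)) ⟩
        (∑[ x ∈ P ] 1)                               ≡⟨ trans (∑-const P 1) (*-identityʳ N) ⟩
        N                                            ∎

    ∑-incidence² : DistinctPoints F P →
                   ∑[ p ∈ pairs ] incidence p * incidence p ≤ N * (q ^ suc e + N * q ^ e)
    ∑-incidence² P! = begin
      (∑[ p ∈ pairs ] incidence p * incidence p)
        ≡⟨ ∑-cartesianProductWith _,_ (λ p → incidence p * incidence p) (points (suc e)) elems ⟩
      (∑[ a ∈ points (suc e) ] ∑[ b ∈ elems ] incidence (a , b) * incidence (a , b))
        ≡⟨ ∑-cong (points (suc e)) ∑-offsets ⟩
      (∑[ a ∈ points (suc e) ] ∑[ x ∈ P ] ∑[ y ∈ P ] 𝟙 (a · x ≟ᶠ a · y))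
        ≡⟨ trans (∑-comm (points (suc e)) P _) (∑-cong P (λ x → ∑-comm (points (suc e)) P _)) ⟩
      (∑[ x ∈ P ] ∑[ y ∈ P ] count (λ a → a · x ≟ᶠ a · y) (points (suc e)))
        ≤⟨ ∑-mono P (λ x → ∑-mono P (count-agreements≤ x)) ⟩
      (∑[ x ∈ P ] ∑[ y ∈ P ] 𝟙 (x ≋? y) * q ^ suc e + q ^ e)
        ≡⟨ ∑-cong P (λ x → trans (∑-distrib-+ P) (cong₂ _+_ (∑-*ʳ (λ y → 𝟙 (x ≋? y)) (q ^ suc e) P)
                                                            (∑-const P (q ^ e)))) ⟩
      (∑[ x ∈ P ] count (x ≋?_) P * q ^ suc e + N * q ^ e)
        ≤⟨ ∑-mono P (λ x → +-monoˡ-≤ (N * q ^ e) (*-monoˡ-≤ (q ^ suc e) (at-most-once x))) ⟩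
      (∑[ x ∈ P ] 1 * q ^ suc e + N * q ^ e)
        ≡⟨ ∑-const P _ ⟩
      N * (1 * q ^ suc e + N * q ^ e)
        ≡⟨ cong (λ t → N * (t + N * q ^ e)) (*-identityˡ (q ^ suc e)) ⟩
      N * (q ^ suc e + N * q ^ e) ∎
      where
      open ≤-Reasoning
      ∑-offsets : ∀ a → ∑[ b ∈ elems ] incidence (a , b) * incidence (a , b) ≡
                        ∑[ x ∈ P ] ∑[ y ∈ P ] 𝟙 (a · x ≟ᶠ a · y)
      ∑-offsets a = begin-equality
        (∑[ b ∈ elems ] incidence (a , b) * incidence (a , b))
          ≡⟨ ∑-cong elems (λ b → ∑*∑ P P (λ x → 𝟙 (a · x ≟ᶠ b)) (λ y → 𝟙 (a · y ≟ᶠ b))) ⟩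
        (∑[ b ∈ elems ] ∑[ x ∈ P ] ∑[ y ∈ P ] 𝟙 (a · x ≟ᶠ b) * 𝟙 (a · y ≟ᶠ b))
          ≡⟨ trans (∑-comm elems P _) (∑-cong P (λ x → ∑-comm elems P _)) ⟩
        (∑[ x ∈ P ] ∑[ y ∈ P ] ∑[ b ∈ elems ] 𝟙 (a · x ≟ᶠ b) * 𝟙 (a · y ≟ᶠ b))
          ≡⟨ ∑-cong P (λ x → ∑-cong P (λ y → ∑-common-offsets (a · x) (a · y))) ⟩
        (∑[ x ∈ P ] ∑[ y ∈ P ] 𝟙 (a · x ≟ᶠ a · y)) ∎
      count-agreements≤ : ∀ x y → count (λ a → a · x ≟ᶠ a · y) (points (suc e)) ≤
                                  𝟙 (x ≋? y) * q ^ suc e + q ^ e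
      count-agreements≤ x y with x ≋? y
      ... | no x≉y = count-agreements e x≉y
      ... | yes _  = begin
        count (λ a → a · x ≟ᶠ a · y) (points (suc e))
          ≤⟨ ∑-bound (points (suc e)) 1 (λ a → 𝟙≤1 (a · x ≟ᶠ a · y)) ⟩
        length (points (suc e)) * 1  ≡⟨ trans (*-identityʳ _) (length-points (suc e)) ⟩
        q ^ suc e                    ≡⟨ sym (+-identityʳ _) ⟩
        1 * q ^ suc e                ≤⟨ m≤m+n _ (q ^ e) ⟩
        1 * q ^ suc e + q ^ e        ∎
      at-most-once : ∀ x → count (x ≋?_) P ≤ 1
      at-most-once x = count≤1 (x ≋?_) P! (λ x≋y x≋y′ i → ≈-trans (≈-sym (x≋y i)) (x≋y′ i))

    deviation²+2qNk≡q²k²+N² : ∀ p → deviation p * deviation p + 2 * q * N * incidence p ≡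
                                   q * q * (incidence p * incidence p) + N * N
    deviation²+2qNk≡q²k²+N² p = begin
      deviation p * deviation p + 2 * q * N * k   ≡⟨ cong (deviation p * deviation p +_) (swap q N k) ⟩
      deviation p * deviation p + 2 * (q * k) * N ≡⟨ ∣m-n∣²+2mn≡m²+n² (q * k) N ⟩
      q * k * (q * k) + N * N                     ≡⟨ cong (_+ N * N) (square q k) ⟩
      q * q * (k * k) + N * N                     ∎
      where
      open ≡-Reasoning
      k = incidence p
      swap : ∀ q N k → 2 * q * N * k ≡ 2 * (q * k) * N
      swap = solve-∀
      square : ∀ q k → q * k * (q * k) ≡ q * q * (k * k)
      square = solve-∀

    ∑-deviation² : DistinctPoints F P → ∑[ p ∈ pairs ] deviation p * deviation p ≤ q * q * N * q ^ suc e
    ∑-deviation² P! = +-cancelʳ-≤ (2 * q * N * (q ^ suc e * N)) V (q * q * N * q ^ suc e) (begin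
      V + 2 * q * N * (q ^ suc e * N)
        ≡⟨ cong (λ K → V + 2 * q * N * K) (sym ∑-incidence) ⟩
      V + 2 * q * N * ∑ pairs incidence
        ≡⟨ ∑-identity ⟩
      q * q * (∑[ p ∈ pairs ] incidence p * incidence p) + length pairs * (N * N)
        ≤⟨ +-mono-≤ (*-monoʳ-≤ (q * q) (∑-incidence² P!)) (≤-reflexive (cong (_* (N * N)) length-pairs)) ⟩
      q * q * (N * (q * q ^ e + N * q ^ e)) + q * q ^ e * q * (N * N)
        ≡⟨ rearrange q N (q ^ e) ⟩
      q * q * N * q ^ suc e + 2 * q * N * (q ^ suc e * N) ∎)
      where
      open ≤-Reasoning
      V = ∑[ p ∈ pairs ] deviation p * deviation p
      ∑-identity : V + 2 * q * N * ∑ pairs incidence ≡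
                   q * q * (∑[ p ∈ pairs ] incidence p * incidence p) + length pairs * (N * N)
      ∑-identity = begin-equality
        V + 2 * q * N * ∑ pairs incidence
          ≡⟨ cong (V +_) (sym (∑-*ˡ incidence (2 * q * N) pairs)) ⟩
        V + (∑[ p ∈ pairs ] 2 * q * N * incidence p)
          ≡⟨ sym (∑-distrib-+ pairs) ⟩
        (∑[ p ∈ pairs ] deviation p * deviation p + 2 * q * N * incidence p)
          ≡⟨ ∑-cong pairs deviation²+2qNk≡q²k²+N² ⟩
        (∑[ p ∈ pairs ] q * q * (incidence p * incidence p) + N * N)
          ≡⟨ ∑-distrib-+ pairs ⟩
        (∑[ p ∈ pairs ] q * q * (incidence p * incidence p)) + (∑[ p ∈ pairs ] N * N)
          ≡⟨ cong₂ _+_ (∑-*ˡ (λ p → incidence p * incidence p) (q * q) pairs) (∑-const pairs (N * N)) ⟩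
        q * q * (∑[ p ∈ pairs ] incidence p * incidence p) + length pairs * (N * N) ∎
      rearrange : ∀ q N Q → q * q * (N * (q * Q + N * Q)) + q * Q * q * (N * N) ≡
                            q * q * N * (q * Q) + 2 * q * N * (q * Q * N)
      rearrange = solve-∀

    incidence-resp : ∀ {p p′} → Pointwise _≋_ _≈_ p p′ → incidence p ≡ incidence p′
    incidence-resp {a , b} {a′ , b′} (a≋a′ , b≈b′) =
      count-cong (λ x → a · x ≟ᶠ b) (λ x → a′ · x ≟ᶠ b′)
        (λ {x} ax≈b → ≈-trans (≈-sym (dot-congˡ x a≋a′)) (≈-trans ax≈b b≈b′))
        (λ {x} a′x≈b′ → ≈-trans (dot-congˡ x a≋a′) (≈-trans a′x≈b′ (≈-sym b≈b′))) P

    incidence-scale : ∀ π c → incidence (scale π c) ≡ intersectionSize F π P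
    incidence-scale (hyp a b _) (c , c≉0) = begin
      count (λ x → (λ i → c *ᶠ a i) · x ≟ᶠ c *ᶠ b) P
        ≡⟨ count-cong _ (λ x → a · x ≟ᶠ b) (λ {x} → unscale x) (λ {x} → rescale x) P ⟩
      count (λ x → a · x ≟ᶠ b) P
        ≡⟨ sym (length-filter≡count (λ x → a · x ≟ᶠ b) P) ⟩
      length (filter (λ x → a · x ≟ᶠ b) P) ∎
      where
      open ≡-Reasoning
      unscale : ∀ x → (λ i → c *ᶠ a i) · x ≈ c *ᶠ b → a · x ≈ b
      unscale x cax≈cb = *ᶠ-cancelˡ-≉0 c≉0 (≈-trans (≈-sym (dot-*ˡ c a x)) cax≈cb)
      rescale : ∀ x → a · x ≈ b → (λ i → c *ᶠ a i) · x ≈ c *ᶠ b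
      rescale x ax≈b = ≈-trans (dot-*ˡ c a x) (*ᶠ-cong ≈-refl ax≈b)

    unbalanced⇒N²<4deviation² : ∀ π → Unbalanced F P π → ∀ c →
                                 N * N < 4 * (deviation (scale π c) * deviation (scale π c))
    unbalanced⇒N²<4deviation² π unbalanced c rewrite incidence-scale π c =
      subst (N * N <_) (square-double D) (*-mono-< N<2D N<2D)
      where
      k = intersectionSize F π P
      D = ∣ q * k - N ∣
      N<2D : N < 2 * D
      N<2D = n<2∣m-n∣ (q * k) N (map₁ (subst (_< N) (*-assoc 2 q k)) unbalanced)
      square-double : ∀ D → 2 * D * (2 * D) ≡ 4 * (D * D)
      square-double = solve-∀

    copies-bound : ∀ {H} → DistinctHyperplanes F H → All (Unbalanced F P) H →
                   length H * length units * (N * N) ≤ 4 * (∑[ p ∈ pairs ] deviation p * deviation p)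
    copies-bound {H} H! unbalanced = begin
      length H * length units * (N * N)
        ≡⟨ cong (_* (N * N)) (sym (length-cartesianProductWith scale H units)) ⟩
      length (copies H) * (N * N)
        ≡⟨ sym (∑-const (copies H) (N * N)) ⟩
      (∑[ p ∈ copies H ] N * N)
        ≤⟨ ∑-monoᴬ (Allₚ.cartesianProductWith⁺ (≡.setoid _) (≡.setoid _) scale H units copy-unbalanced) ⟩
      (∑[ p ∈ copies H ] 4 * (deviation p * deviation p))
        ≡⟨ ∑-*ˡ (λ p → deviation p * deviation p) 4 (copies H) ⟩
      4 * (∑[ p ∈ copies H ] deviation p * deviation p)
        ≤⟨ *-monoʳ-≤ 4 (∑-mono-⊆ (≋-setoid (suc e) ×ₛ setoid) (×-decidable _≋?_ _≟ᶠ_) deviation²-resp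
                                 (copies-unique H!) (λ {v} _ → pairs-complete v)) ⟩
      4 * (∑[ p ∈ pairs ] deviation p * deviation p) ∎
      where
      open ≤-Reasoning
      copy-unbalanced : ∀ {π c} → π ∈ₚ H → c ∈ₚ units →
                        N * N ≤ 4 * (deviation (scale π c) * deviation (scale π c))
      copy-unbalanced {π} {c} π∈H _ = <⇒≤ (unbalanced⇒N²<4deviation² π (All.lookup unbalanced π∈H) c)
      deviation²-resp : ∀ {p p′} → Pointwise _≋_ _≈_ p p′ →
                        deviation p * deviation p ≡ deviation p′ * deviation p′
      deviation²-resp p≈p′ = cong (λ k → ∣ q * k - N ∣ * ∣ q * k - N ∣) (incidence-resp p≈p′)
      pairs-complete : ∀ v → Any (Pointwise _≋_ _≈_ v) pairs
      pairs-complete (a , b) = Anyₚ.cartesianProduct⁺ (points-complete (suc e) a) (elems-complete b)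

    hyperplane-bound : DistinctPoints F P → 1 ≤ N →
                       ∀ {H} → DistinctHyperplanes F H → All (Unbalanced F P) H →
                       length H * N ≤ 8 * (q * q ^ suc e)
    hyperplane-bound P! 1≤N {H} H! unbalanced =
      *-cancelʳ-≤ (length H * N) (8 * (q * Q)) (m * N) {{>-nonZero (*-mono-≤ 1≤length-units 1≤N)}} (begin
        length H * N * (m * N)                          ≡⟨ regroup (length H) N m ⟩
        length H * m * (N * N)                          ≤⟨ copies-bound H! unbalanced ⟩
        4 * (∑[ p ∈ pairs ] deviation p * deviation p)  ≤⟨ *-monoʳ-≤ 4 (∑-deviation² P!) ⟩
        4 * (q * q * N * Q)                             ≤⟨ *-monoʳ-≤ 4 q²NQ≤q[2m]NQ ⟩
        4 * (q * (2 * m) * N * Q)                       ≡⟨ regroup′ q m N Q ⟩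
        8 * (q * Q) * (m * N)                           ∎)
      where
      open ≤-Reasoning
      m = length units
      Q = q ^ suc e
      q²NQ≤q[2m]NQ : q * q * N * Q ≤ q * (2 * m) * N * Q
      q²NQ≤q[2m]NQ = *-monoˡ-≤ Q (*-monoˡ-≤ N (*-monoʳ-≤ q q≤2*length-units))
      regroup : ∀ h N m → h * N * (m * N) ≡ h * m * (N * N)
      regroup = solve-∀
      regroup′ : ∀ q m N Q → 4 * (q * (2 * m) * N * Q) ≡ 8 * (q * Q) * (m * N)
      regroup′ = solve-∀

lemma3p3 : (d : ℕ) → 1 ≤ d → (q : ℕ) → (F : FiniteField q) →
    (P : List (Point F d)) → DistinctPoints F P → 1 ≤ length P →
    (H : List (Hyperplane F d)) → DistinctHyperplanes F H →
    All (Unbalanced F P) H →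
    length H * length P ≤ 8 * q ^ (d + 1)
lemma3p3 zero    () q F P P! 1≤N H H! unbalanced
lemma3p3 (suc e) _  q F P P! 1≤N H H! unbalanced =
  subst (λ t → length H * length P ≤ 8 * t) (cong (q ^_) (+-comm 1 (suc e)))
        (hyperplane-bound F e P P! 1≤N H! unbalanced)
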